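{- Let $t\geq1$, $j\geq k\geq t+2$ and $0\leq s\leq k-t-2$. Then: (i) $S(n-t-s,k-t-s)>(t+1)(j-t+1)\,S(n-t-s-1,k-t-s-1)$ for $n\geq L(j,t)-1$; (ii) $S(n-t-s,k-t-s)>(t+1)^2(j-t+1)^2\,S(n-t-s-1,k-t-s-1)$ for $n\geq2L(j,t)-t-2$.
   Context: $S(m,k)$ is the Stirling number of the second kind (number of partitions of an $m$-set into $k$ non-empty blocks). $L(k,t)=(t+1)+(k-t+1)\log_2\big((t+1)(k-t+1)\big)$. -}

module Defs where

open import Data.Nat using (ℕ; zero; suc; _+_; _*_)

S : ℕ → ℕ → ℕ
S zero    zero    = 1
S (suc m) zero    = 0
S zero    (suc k) = 0
S (suc m) (suc k) = suc k * S m (suc k) + S m k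

-- With p = k-t-s-1 and m = n-t-s, the identity n^m = Σ_i n(n-1)⋯(n-i+1) S(m,i) gives
-- p! S(e,p) ≤ p^e and (p+1)^m ≤ (p+1) p^m + (p+1)! S(m,p+1); combined, they yield
-- D S(m-1,p) < S(m,p+1) whenever p^(m-1) (D+p) < (p+1)^(m-1). For p ≥ 2 that inequality follows
-- from D^(p+2) ≤ 2^m by raising it to the power p+2 and using (1+1/p)^(p+2) ≥ 5/2 together with
-- (5/4)^e > 2 (3/2)^(p+2) for e ≥ 3(p+2)-1; for p = 1 it is a direct check. The hypothesis of
-- part (i), resp. (ii), gives D^(p+2) ≤ 2^m for D = (t+1)(j-t+1), resp. D².
module Submission where

open import Defs
open import Data.Nat using (ℕ; _+_; _*_; _∸_; _^_; _≤_; _<_)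
open import Data.Nat.Base using (zero; suc; _!; z≤n; s≤s; s≤s⁻¹; >-nonZero)
open import Data.Nat.Properties
open import Data.Nat.Combinatorics.Base using (_P′_)
open import Data.Nat.Combinatorics.Specification using (nP′k≡n[n∸1P′k∸1])
open import Data.Nat.Tactic.RingSolver using (solve-∀)
open import Data.Product using (_×_; _,_)
open import Data.Unit using (tt)
open import Relation.Binary.PropositionalEquality
open import Relation.Nullary using (yes; no; contradiction)

∑< : ℕ → (ℕ → ℕ) → ℕ
∑< zero    f = 0
∑< (suc n) f = ∑< n f + f n

syntax ∑< n (λ i → e) = ∑[ i < n ] e

∑-cong : ∀ n {f g : ℕ → ℕ} → (∀ i → f i ≡ g i) → ∑< n f ≡ ∑< n g
∑-cong zero    f≡g = refl
∑-cong (suc n) f≡g = cong₂ _+_ (∑-cong n f≡g) (f≡g n)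

∑-zero : ∀ n → ∑[ i < n ] 0 ≡ 0
∑-zero zero    = refl
∑-zero (suc n) = cong (_+ 0) (∑-zero n)

∑-distrib-+ : ∀ n (f g : ℕ → ℕ) → ∑[ i < n ] (f i + g i) ≡ ∑< n f + ∑< n g
∑-distrib-+ zero    f g = refl
∑-distrib-+ (suc n) f g = begin
  ∑[ i < n ] (f i + g i) + (f n + g n) ≡⟨ cong (_+ (f n + g n)) (∑-distrib-+ n f g) ⟩
  ∑< n f + ∑< n g + (f n + g n)        ≡⟨ interchange (∑< n f) (∑< n g) (f n) (g n) ⟩
  ∑< n f + f n + (∑< n g + g n)        ∎
  where
  open ≡-Reasoning
  interchange : ∀ a b c d → a + b + (c + d) ≡ a + c + (b + d)
  interchange = solve-∀

*-distribˡ-∑ : ∀ c n (f : ℕ → ℕ) → c * ∑< n f ≡ ∑[ i < n ] (c * f i)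
*-distribˡ-∑ c zero    f = *-zeroʳ c
*-distribˡ-∑ c (suc n) f =
  trans (*-distribˡ-+ c (∑< n f) (f n)) (cong (_+ c * f n) (*-distribˡ-∑ c n f))

∑-shift : ∀ n (f : ℕ → ℕ) → ∑< (suc n) f ≡ f 0 + ∑[ i < n ] f (suc i)
∑-shift zero    f = +-comm 0 (f 0)
∑-shift (suc n) f = trans (cong (_+ f (suc n)) (∑-shift n f)) (+-assoc (f 0) _ _)

∑-mono-≤ : ∀ n {f g : ℕ → ℕ} → (∀ i → i < n → f i ≤ g i) → ∑< n f ≤ ∑< n g
∑-mono-≤ zero    f≤g = z≤n
∑-mono-≤ (suc n) f≤g =
  +-mono-≤ (∑-mono-≤ n (λ i i<n → f≤g i (m<n⇒m<1+n i<n))) (f≤g n ≤-refl)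

2*∑[i<1+n]i≡n*[1+n] : ∀ n → 2 * ∑[ i < suc n ] i ≡ n * suc n
2*∑[i<1+n]i≡n*[1+n] zero    = refl
2*∑[i<1+n]i≡n*[1+n] (suc n) = begin
  2 * (∑[ i < suc n ] i + suc n)   ≡⟨ *-distribˡ-+ 2 (∑[ i < suc n ] i) (suc n) ⟩
  2 * ∑[ i < suc n ] i + 2 * suc n ≡⟨ cong (_+ 2 * suc n) (2*∑[i<1+n]i≡n*[1+n] n) ⟩
  n * suc n + 2 * suc n            ≡⟨ n*[1+n]+2*[1+n] n ⟩
  suc n * suc (suc n)              ∎
  where
  open ≡-Reasoning
  n*[1+n]+2*[1+n] : ∀ n → n * suc n + 2 * suc n ≡ suc n * suc (suc n)
  n*[1+n]+2*[1+n] = solve-∀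

n≤k⇒nP′[1+k]≡0 : ∀ {n k} → n ≤ k → n P′ suc k ≡ 0
n≤k⇒nP′[1+k]≡0 {n} {k} n≤k = cong (_* (n P′ k)) (m≤n⇒m∸n≡0 n≤k)

nP′k*k+nP′[1+k]≡n*nP′k : ∀ n k → (n P′ k) * k + n P′ suc k ≡ n * (n P′ k)
nP′k*k+nP′[1+k]≡n*nP′k n zero = refl
nP′k*k+nP′[1+k]≡n*nP′k n (suc k) with n ≤? k
... | yes n≤k rewrite n≤k⇒nP′[1+k]≡0 n≤k | *-zeroʳ (n ∸ suc k) | *-zeroʳ n = refl
... | no  n≰k = begin
  (n P′ suc k) * suc k + (n ∸ suc k) * (n P′ suc k) ≡⟨ cong (_+ (n ∸ suc k) * (n P′ suc k)) (*-comm (n P′ suc k) (suc k)) ⟩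
  suc k * (n P′ suc k) + (n ∸ suc k) * (n P′ suc k) ≡⟨ *-distribʳ-+ (n P′ suc k) (suc k) (n ∸ suc k) ⟨
  (suc k + (n ∸ suc k)) * (n P′ suc k)               ≡⟨ cong (_* (n P′ suc k)) (m+[n∸m]≡n (≰⇒> n≰k)) ⟩
  n * (n P′ suc k)                                   ∎
  where open ≡-Reasoning

nP′n≡n! : ∀ n → n P′ n ≡ n !
nP′n≡n! zero    = refl
nP′n≡n! (suc n) = trans (nP′k≡n[n∸1P′k∸1] (suc n) (suc n)) (cong (suc n *_) (nP′n≡n! n))

[1+n]P′k≤[1+n]*nP′k : ∀ {n k} → k ≤ n → suc n P′ k ≤ suc n * (n P′ k)
[1+n]P′k≤[1+n]*nP′k {n} {k} k≤n = begin
  suc n P′ k                 ≤⟨ m≤n*m (suc n P′ k) (suc n ∸ k) {{>-nonZero (m<n⇒0<n∸m (s≤s k≤n))}} ⟩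
  (suc n ∸ k) * (suc n P′ k) ≡⟨ nP′k≡n[n∸1P′k∸1] (suc n) (suc k) ⟩
  suc n * (n P′ k)           ∎
  where open ≤-Reasoning

n^m≡∑nP′i*S[m,i] : ∀ n m → n ^ m ≡ ∑[ i < suc n ] ((n P′ i) * S m i)
n^m≡∑nP′i*S[m,i] n zero = sym (begin
  ∑[ i < suc n ] ((n P′ i) * S zero i)        ≡⟨ ∑-shift n _ ⟩
  1 + ∑[ i < n ] ((n P′ suc i) * 0)          ≡⟨ cong suc (∑-cong n (λ i → *-zeroʳ (n P′ suc i))) ⟩
  1 + ∑[ i < n ] 0                            ≡⟨ cong suc (∑-zero n) ⟩
  1                                           ∎)
  where open ≡-Reasoning
n^m≡∑nP′i*S[m,i] n (suc m) = begin
  n * n ^ m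
    ≡⟨ cong (n *_) (n^m≡∑nP′i*S[m,i] n m) ⟩
  n * ∑[ i < suc n ] ((n P′ i) * S m i)
    ≡⟨ *-distribˡ-∑ n (suc n) _ ⟩
  ∑[ i < suc n ] (n * ((n P′ i) * S m i))
    ≡⟨ ∑-cong (suc n) split ⟩
  ∑[ i < suc n ] ((n P′ i) * i * S m i + (n P′ suc i) * S m i)
    ≡⟨ ∑-distrib-+ (suc n) _ _ ⟩
  ∑[ i < suc n ] ((n P′ i) * i * S m i) + ∑[ i < suc n ] ((n P′ suc i) * S m i)
    ≡⟨ cong₂ _+_ (∑-shift n _) dropLast ⟩
  ∑[ i < n ] ((n P′ suc i) * suc i * S m (suc i)) + ∑[ i < n ] ((n P′ suc i) * S m i)
    ≡⟨ ∑-distrib-+ n _ _ ⟨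
  ∑[ i < n ] ((n P′ suc i) * suc i * S m (suc i) + (n P′ suc i) * S m i)
    ≡⟨ ∑-cong n (λ i → factor (n P′ suc i) (suc i) (S m (suc i)) (S m i)) ⟩
  ∑[ i < n ] ((n P′ suc i) * S (suc m) (suc i))
    ≡⟨ ∑-shift n _ ⟨
  ∑[ i < suc n ] ((n P′ i) * S (suc m) i) ∎
  where
  open ≡-Reasoning
  split : ∀ i → n * ((n P′ i) * S m i) ≡ (n P′ i) * i * S m i + (n P′ suc i) * S m i
  split i = begin
    n * ((n P′ i) * S m i)                      ≡⟨ *-assoc n (n P′ i) (S m i) ⟨
    n * (n P′ i) * S m i                        ≡⟨ cong (_* S m i) (nP′k*k+nP′[1+k]≡n*nP′k n i) ⟨
    ((n P′ i) * i + n P′ suc i) * S m i         ≡⟨ *-distribʳ-+ (S m i) ((n P′ i) * i) (n P′ suc i) ⟩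
    (n P′ i) * i * S m i + (n P′ suc i) * S m i ∎
  dropLast : ∑[ i < suc n ] ((n P′ suc i) * S m i) ≡ ∑[ i < n ] ((n P′ suc i) * S m i)
  dropLast = trans (cong (λ z → ∑[ i < n ] ((n P′ suc i) * S m i) + z * (n P′ n) * S m n) (n∸n≡0 n))
                   (+-identityʳ _)
  factor : ∀ a b x y → a * b * x + a * y ≡ a * (b * x + y)
  factor = solve-∀

n!*S[m,n]≤n^m : ∀ m n → n ! * S m n ≤ n ^ m
n!*S[m,n]≤n^m m n = begin
  n ! * S m n                           ≡⟨ cong (_* S m n) (nP′n≡n! n) ⟨
  (n P′ n) * S m n                      ≤⟨ m≤n+m _ _ ⟩
  ∑[ i < suc n ] ((n P′ i) * S m i)     ≡⟨ n^m≡∑nP′i*S[m,i] n m ⟨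
  n ^ m                                 ∎
  where open ≤-Reasoning

[1+n]^m≤[1+n]*n^m+[1+n]!*S[m,1+n] : ∀ m n → suc n ^ m ≤ suc n * n ^ m + suc n ! * S m (suc n)
[1+n]^m≤[1+n]*n^m+[1+n]!*S[m,1+n] m n = begin
  suc n ^ m
    ≡⟨ n^m≡∑nP′i*S[m,i] (suc n) m ⟩
  ∑[ i < suc n ] ((suc n P′ i) * S m i) + (suc n P′ suc n) * S m (suc n)
    ≤⟨ +-mono-≤ lower-terms (≤-reflexive (cong (_* S m (suc n)) (nP′n≡n! (suc n)))) ⟩
  suc n * n ^ m + suc n ! * S m (suc n) ∎
  where
  open ≤-Reasoning
  lower-terms : ∑[ i < suc n ] ((suc n P′ i) * S m i) ≤ suc n * n ^ m
  lower-terms = begin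
    ∑[ i < suc n ] ((suc n P′ i) * S m i)
      ≤⟨ ∑-mono-≤ (suc n) (λ i i<1+n → *-monoˡ-≤ (S m i) ([1+n]P′k≤[1+n]*nP′k (s≤s⁻¹ i<1+n))) ⟩
    ∑[ i < suc n ] (suc n * (n P′ i) * S m i)
      ≡⟨ ∑-cong (suc n) (λ i → *-assoc (suc n) (n P′ i) (S m i)) ⟩
    ∑[ i < suc n ] (suc n * ((n P′ i) * S m i))
      ≡⟨ *-distribˡ-∑ (suc n) (suc n) _ ⟨
    suc n * ∑[ i < suc n ] ((n P′ i) * S m i)
      ≡⟨ cong (suc n *_) (n^m≡∑nP′i*S[m,i] n m) ⟨
    suc n * n ^ m ∎

p^e*[D+p]<[1+p]^e⇒D*S[e,p]<S[1+e,1+p] : ∀ p e D → p ^ e * (D + p) < suc p ^ e → D * S e p < S (suc e) (suc p)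
p^e*[D+p]<[1+p]^e⇒D*S[e,p]<S[1+e,1+p] p e D gap = *-cancelˡ-< (p !) _ _ (begin-strict
  p ! * (D * S e p)   ≡⟨ x*[y*z]≡y*[x*z] (p !) D (S e p) ⟩
  D * (p ! * S e p)   ≤⟨ *-monoʳ-≤ D (n!*S[m,n]≤n^m e p) ⟩
  D * p ^ e           <⟨ +-cancelˡ-< (p * p ^ e) _ _ p*p^e+D*p^e<p*p^e+p!*X ⟩
  p ! * X             ∎)
  where
  open ≤-Reasoning
  X = S (suc e) (suc p)
  x*[y*z]≡y*[x*z] : ∀ x y z → x * (y * z) ≡ y * (x * z)
  x*[y*z]≡y*[x*z] = solve-∀
  expand : ∀ a b c → a * (b + c) ≡ c * a + b * a
  expand = solve-∀
  [1+p]^e≤p*p^e+p!*X : suc p ^ e ≤ p * p ^ e + p ! * X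
  [1+p]^e≤p*p^e+p!*X = *-cancelˡ-≤ (suc p) (begin
    suc p * suc p ^ e                     ≤⟨ [1+n]^m≤[1+n]*n^m+[1+n]!*S[m,1+n] (suc e) p ⟩
    suc p * (p * p ^ e) + suc p * p ! * X ≡⟨ cong (suc p * (p * p ^ e) +_) (*-assoc (suc p) (p !) X) ⟩
    suc p * (p * p ^ e) + suc p * (p ! * X) ≡⟨ *-distribˡ-+ (suc p) (p * p ^ e) (p ! * X) ⟨
    suc p * (p * p ^ e + p ! * X)         ∎)
  p*p^e+D*p^e<p*p^e+p!*X : p * p ^ e + D * p ^ e < p * p ^ e + p ! * X
  p*p^e+D*p^e<p*p^e+p!*X = begin-strict
    p * p ^ e + D * p ^ e ≡⟨ expand (p ^ e) D p ⟨
    p ^ e * (D + p)       <⟨ gap ⟩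
    suc p ^ e             ≤⟨ [1+p]^e≤p*p^e+p!*X ⟩
    p * p ^ e + p ! * X   ∎

^-distribʳ-* : ∀ m n o → (m * n) ^ o ≡ m ^ o * n ^ o
^-distribʳ-* m n zero    = refl
^-distribʳ-* m n (suc o) = trans (cong (m * n *_) (^-distribʳ-* m n o)) (interchange m n (m ^ o) (n ^ o))
  where
  interchange : ∀ a b x y → a * b * (x * y) ≡ a * x * (b * y)
  interchange = solve-∀

[m^n]^o≡[m^o]^n : ∀ m n o → (m ^ n) ^ o ≡ (m ^ o) ^ n
[m^n]^o≡[m^o]^n m n o = begin
  (m ^ n) ^ o ≡⟨ ^-*-assoc m n o ⟩
  m ^ (n * o) ≡⟨ cong (m ^_) (*-comm n o) ⟩
  m ^ (o * n) ≡⟨ ^-*-assoc m o n ⟨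
  (m ^ o) ^ n ∎
  where open ≡-Reasoning

^-cancelˡ-≤ : ∀ {m n} o → 1 < o → o ^ m ≤ o ^ n → m ≤ n
^-cancelˡ-≤ {m} {n} o 1<o oᵐ≤oⁿ with m ≤? n
... | yes m≤n = m≤n
... | no  m≰n = contradiction oᵐ≤oⁿ (<⇒≱ (^-monoʳ-< o 1<o (≰⇒> m≰n)))

^-cancelʳ-< : ∀ {m n} o → m ^ o < n ^ o → m < n
^-cancelʳ-< {m} {n} o mᵒ<nᵒ with n ≤? m
... | yes n≤m = contradiction (^-monoˡ-≤ o n≤m) (<⇒≱ mᵒ<nᵒ)
... | no  n≰m = ≰⇒> n≰m

2*3^u*4^e<5^e*2^u : ∀ {u e} → 4 ≤ u → 3 * u ≤ suc e → 2 * 3 ^ u * 4 ^ e < 5 ^ e * 2 ^ u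
2*3^u*4^e<5^e*2^u {u} {e} 4≤u 3u≤1+e with m≤n⇒∃[o]m+o≡n 4≤u
... | v , refl = subst Gap (m∸n+n≡m e₀≤e) (raise (e ∸ e₀) (base v))
  where
  open ≤-Reasoning
  Gap : ℕ → Set
  Gap e = 2 * 3 ^ (4 + v) * 4 ^ e < 5 ^ e * 2 ^ (4 + v)
  -- e₀ = 3u - 1, written so that raising v by one adds constructors to both exponents
  e₀ = v * 3 + 11
  e₀≤e : e₀ ≤ e
  e₀≤e = s≤s⁻¹ (≤-trans (≤-reflexive (exponent v)) 3u≤1+e)
    where
    exponent : ∀ v → suc (v * 3 + 11) ≡ 3 * (4 + v)
    exponent = solve-∀
  raise : ∀ d {e} → Gap e → Gap (d + e)
  raise zero    gap = gap
  raise (suc d) {e} gap = begin-strict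
    2 * 3 ^ (4 + v) * (4 * 4 ^ (d + e)) ≡⟨ shuffle (3 ^ (4 + v)) (4 ^ (d + e)) ⟩
    4 * (2 * 3 ^ (4 + v) * 4 ^ (d + e)) <⟨ *-monoʳ-< 4 (raise d gap) ⟩
    4 * (5 ^ (d + e) * 2 ^ (4 + v))     ≤⟨ *-monoˡ-≤ (5 ^ (d + e) * 2 ^ (4 + v)) (n≤1+n 4) ⟩
    5 * (5 ^ (d + e) * 2 ^ (4 + v))     ≡⟨ *-assoc 5 (5 ^ (d + e)) (2 ^ (4 + v)) ⟨
    5 * 5 ^ (d + e) * 2 ^ (4 + v)       ∎
    where
    shuffle : ∀ x y → 2 * x * (4 * y) ≡ 4 * (2 * x * y)
    shuffle = solve-∀
  base : ∀ v → 2 * 3 ^ (4 + v) * 4 ^ (v * 3 + 11) < 5 ^ (v * 3 + 11) * 2 ^ (4 + v)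
  base zero    = ≤ᵇ⇒≤ (suc (2 * 3 ^ 4 * 4 ^ 11)) (5 ^ 11 * 2 ^ 4) tt
  base (suc v) = begin-strict
    2 * (3 * 3 ^ (4 + v)) * (4 * (4 * (4 * 4 ^ (v * 3 + 11))))
      ≡⟨ shuffle (3 ^ (4 + v)) (4 ^ (v * 3 + 11)) ⟩
    192 * (2 * 3 ^ (4 + v) * 4 ^ (v * 3 + 11))
      <⟨ *-monoʳ-< 192 (base v) ⟩
    192 * (5 ^ (v * 3 + 11) * 2 ^ (4 + v))
      ≤⟨ *-monoˡ-≤ (5 ^ (v * 3 + 11) * 2 ^ (4 + v)) (≤ᵇ⇒≤ 192 250 tt) ⟩
    250 * (5 ^ (v * 3 + 11) * 2 ^ (4 + v))
      ≡⟨ unshuffle (5 ^ (v * 3 + 11)) (2 ^ (4 + v)) ⟩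
    5 * (5 * (5 * 5 ^ (v * 3 + 11))) * (2 * 2 ^ (4 + v)) ∎
    where
    shuffle : ∀ x y → 2 * (3 * x) * (4 * (4 * (4 * y))) ≡ 192 * (2 * x * y)
    shuffle = solve-∀
    unshuffle : ∀ x y → 250 * (x * y) ≡ 5 * (5 * (5 * x)) * (2 * y)
    unshuffle = solve-∀

bernoulli₂ : ∀ p n → p ^ n * (p * p + n * p + ∑[ i < n ] i) ≤ suc p ^ n * (p * p)
bernoulli₂ p zero    = ≤-reflexive (base p)
  where
  base : ∀ p → 1 * (p * p + 0 * p + 0) ≡ 1 * (p * p)
  base = solve-∀
bernoulli₂ p (suc n) = begin
  p * p ^ n * (p * p + (p + n * p) + (T + n))               ≤⟨ m≤m+n _ (p ^ n * T) ⟩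
  p * p ^ n * (p * p + (p + n * p) + (T + n)) + p ^ n * T   ≡⟨ expand p n (p ^ n) T ⟩
  suc p * (p ^ n * (p * p + n * p + T))                     ≤⟨ *-monoʳ-≤ (suc p) (bernoulli₂ p n) ⟩
  suc p * (suc p ^ n * (p * p))                             ≡⟨ *-assoc (suc p) (suc p ^ n) (p * p) ⟨
  suc p * suc p ^ n * (p * p)                               ∎
  where
  open ≤-Reasoning
  T = ∑[ i < n ] i
  expand : ∀ p n x t → p * x * (p * p + (p + n * p) + (t + n)) + x * t ≡ (1 + p) * (x * (p * p + n * p + t))
  expand = solve-∀

5*p^[2+p]≤2*[1+p]^[2+p] : ∀ p → 5 * p ^ (2 + p) ≤ 2 * suc p ^ (2 + p)
5*p^[2+p]≤2*[1+p]^[2+p] zero      = z≤n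
5*p^[2+p]≤2*[1+p]^[2+p] p@(suc _) = *-cancelʳ-≤ _ _ (p * p) (begin
  5 * p ^ u * (p * p)                    ≡⟨ shuffle (p ^ u) (p * p) ⟩
  p ^ u * (5 * (p * p))                  ≤⟨ *-monoʳ-≤ (p ^ u) quadratic ⟩
  p ^ u * (2 * (p * p + u * p + T))      ≡⟨ shuffle′ (p ^ u) (p * p + u * p + T) ⟩
  2 * (p ^ u * (p * p + u * p + T))      ≤⟨ *-monoʳ-≤ 2 (bernoulli₂ p u) ⟩
  2 * (suc p ^ u * (p * p))              ≡⟨ *-assoc 2 (suc p ^ u) (p * p) ⟨
  2 * suc p ^ u * (p * p)                ∎)
  where
  open ≤-Reasoning
  u = 2 + p
  T = ∑[ i < u ] i
  quadratic : 5 * (p * p) ≤ 2 * (p * p + u * p + T)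
  quadratic = begin
    5 * (p * p)                        ≤⟨ m≤m+n (5 * (p * p)) (7 * p + 2) ⟩
    5 * (p * p) + (7 * p + 2)          ≡⟨ expand p ⟩
    2 * (p * p + u * p) + suc p * u    ≡⟨ cong (2 * (p * p + u * p) +_) (2*∑[i<1+n]i≡n*[1+n] (suc p)) ⟨
    2 * (p * p + u * p) + 2 * T        ≡⟨ *-distribˡ-+ 2 (p * p + u * p) T ⟨
    2 * (p * p + u * p + T)            ∎
    where
    expand : ∀ p → 5 * (p * p) + (7 * p + 2) ≡ 2 * (p * p + (2 + p) * p) + suc p * (2 + p)
    expand = solve-∀
  shuffle : ∀ x y → 5 * x * y ≡ x * (5 * y)
  shuffle = solve-∀
  shuffle′ : ∀ x y → x * (2 * y) ≡ 2 * (x * y)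
  shuffle′ = solve-∀

p^e*[D+p]<[1+p]^e-2≤p : ∀ {p e D} → 2 ≤ p → 2 * (2 + p) ≤ D → D ^ (2 + p) ≤ 2 ^ suc e →
                         p ^ e * (D + p) < suc p ^ e
p^e*[D+p]<[1+p]^e-2≤p {p} {e} {D} 2≤p@(s≤s (s≤s _)) 2[2+p]≤D Dᵘ≤2^[1+e] =
  ^-cancelʳ-< u (*-cancelˡ-< (2 ^ u * 2 ^ e) _ _ (begin-strict
    2 ^ u * 2 ^ e * (p ^ e * (D + p)) ^ u
      ≡⟨ cong (2 ^ u * 2 ^ e *_) (^-distribʳ-* (p ^ e) (D + p) u) ⟩
    2 ^ u * 2 ^ e * ((p ^ e) ^ u * (D + p) ^ u)
      ≡⟨ shuffle₁ (2 ^ u) (2 ^ e) ((p ^ e) ^ u) ((D + p) ^ u) ⟩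
    2 ^ e * (p ^ e) ^ u * (2 ^ u * (D + p) ^ u)
      ≤⟨ *-monoʳ-≤ (2 ^ e * (p ^ e) ^ u) 2ᵘ[D+p]ᵘ≤3ᵘ*2^[1+e] ⟩
    2 ^ e * (p ^ e) ^ u * (3 ^ u * (2 * 2 ^ e))
      ≡⟨ shuffle₂ (2 ^ e) ((p ^ e) ^ u) (3 ^ u) ⟩
    (p ^ e) ^ u * (2 * 3 ^ u * (2 ^ e * 2 ^ e))
      ≡⟨ cong (λ z → (p ^ e) ^ u * (2 * 3 ^ u * z)) (^-distribʳ-* 2 2 e) ⟨
    (p ^ e) ^ u * (2 * 3 ^ u * 4 ^ e)
      <⟨ *-monoʳ-< ((p ^ e) ^ u) {{m^n≢0 (p ^ e) u {{m^n≢0 p e}}}} (2*3^u*4^e<5^e*2^u 4≤u 3u≤1+e) ⟩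
    (p ^ e) ^ u * (5 ^ e * 2 ^ u)
      ≡⟨ cong (_* (5 ^ e * 2 ^ u)) ([m^n]^o≡[m^o]^n p e u) ⟩
    (p ^ u) ^ e * (5 ^ e * 2 ^ u)
      ≡⟨ shuffle₃ ((p ^ u) ^ e) (5 ^ e) (2 ^ u) ⟩
    2 ^ u * (5 ^ e * (p ^ u) ^ e)
      ≡⟨ cong (2 ^ u *_) (^-distribʳ-* 5 (p ^ u) e) ⟨
    2 ^ u * (5 * p ^ u) ^ e
      ≤⟨ *-monoʳ-≤ (2 ^ u) (^-monoˡ-≤ e (5*p^[2+p]≤2*[1+p]^[2+p] p)) ⟩
    2 ^ u * (2 * suc p ^ u) ^ e
      ≡⟨ cong (2 ^ u *_) (^-distribʳ-* 2 (suc p ^ u) e) ⟩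
    2 ^ u * (2 ^ e * (suc p ^ u) ^ e)
      ≡⟨ cong (λ z → 2 ^ u * (2 ^ e * z)) ([m^n]^o≡[m^o]^n (suc p) u e) ⟩
    2 ^ u * (2 ^ e * (suc p ^ e) ^ u)
      ≡⟨ *-assoc (2 ^ u) (2 ^ e) ((suc p ^ e) ^ u) ⟨
    2 ^ u * 2 ^ e * (suc p ^ e) ^ u ∎))
  where
  open ≤-Reasoning
  u = 2 + p
  4≤u : 4 ≤ u
  4≤u = s≤s (s≤s 2≤p)
  3u≤1+e : 3 * u ≤ suc e
  3u≤1+e = ^-cancelˡ-≤ 2 ≤-refl (begin
    2 ^ (3 * u)   ≡⟨ ^-*-assoc 2 3 u ⟨
    (2 ^ 3) ^ u   ≤⟨ ^-monoˡ-≤ u (≤-trans (*-monoʳ-≤ 2 4≤u) 2[2+p]≤D) ⟩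
    D ^ u         ≤⟨ Dᵘ≤2^[1+e] ⟩
    2 ^ suc e     ∎)
  2[D+p]≤3D : 2 * (D + p) ≤ 3 * D
  2[D+p]≤3D = begin
    2 * (D + p)   ≡⟨ *-distribˡ-+ 2 D p ⟩
    2 * D + 2 * p ≤⟨ +-monoʳ-≤ (2 * D) (≤-trans (*-monoʳ-≤ 2 (m≤n+m p 2)) 2[2+p]≤D) ⟩
    2 * D + D     ≡⟨ +-comm (2 * D) D ⟩
    3 * D         ∎
  2ᵘ[D+p]ᵘ≤3ᵘ*2^[1+e] : 2 ^ u * (D + p) ^ u ≤ 3 ^ u * 2 ^ suc e
  2ᵘ[D+p]ᵘ≤3ᵘ*2^[1+e] = begin
    2 ^ u * (D + p) ^ u ≡⟨ ^-distribʳ-* 2 (D + p) u ⟨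
    (2 * (D + p)) ^ u   ≤⟨ ^-monoˡ-≤ u 2[D+p]≤3D ⟩
    (3 * D) ^ u         ≡⟨ ^-distribʳ-* 3 D u ⟩
    3 ^ u * D ^ u       ≤⟨ *-monoʳ-≤ (3 ^ u) Dᵘ≤2^[1+e] ⟩
    3 ^ u * 2 ^ suc e   ∎
  shuffle₁ : ∀ a b x y → a * b * (x * y) ≡ b * x * (a * y)
  shuffle₁ = solve-∀
  shuffle₂ : ∀ a x t → a * x * (t * (2 * a)) ≡ x * (2 * t * (a * a))
  shuffle₂ = solve-∀
  shuffle₃ : ∀ a b c → a * (b * c) ≡ c * (b * a)
  shuffle₃ = solve-∀

p^e*[D+p]<[1+p]^e : ∀ {p e D} → 1 ≤ p → 2 * (2 + p) ≤ D → D ^ (2 + p) ≤ 2 ^ suc e →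
                     p ^ e * (D + p) < suc p ^ e
p^e*[D+p]<[1+p]^e {suc (suc _)} {e} {D} _ = p^e*[D+p]<[1+p]^e-2≤p {e = e} {D = D} (s≤s (s≤s z≤n))
p^e*[D+p]<[1+p]^e {1} {e} {D} _ 6≤D D³≤2^[1+e] with m≤n⇒∃[o]m+o≡n 6≤D
... | x , refl = *-cancelˡ-< 2 _ _ (begin-strict
  2 * (1 ^ e * (D + 1)) ≡⟨ cong (λ z → 2 * (z * (D + 1))) (^-zeroˡ e) ⟩
  2 * (1 * (D + 1))     <⟨ m≤m+n _ _ ⟩
  _                     ≡⟨ cube x ⟨
  D ^ 3                 ≤⟨ D³≤2^[1+e] ⟩
  2 ^ suc e             ∎)
  where
  open ≤-Reasoning
  cube : ∀ x → (6 + x) * ((6 + x) * ((6 + x) * 1)) ≡ suc (2 * (1 * (6 + x + 1))) + (201 + 106 * x + 18 * (x * x) + x * (x * x))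
  cube = solve-∀

D*S[m∸1,p]<S[m,1+p] : ∀ {p D} m → 1 ≤ p → 2 * (2 + p) ≤ D → D ^ (2 + p) ≤ 2 ^ m →
                       D * S (m ∸ 1) p < S m (suc p)
D*S[m∸1,p]<S[m,1+p] {p} {D} zero _ 2[2+p]≤D Dᵘ≤1 =
  contradiction (^-cancelˡ-≤ {2 + p} {0} 2 ≤-refl (≤-trans (^-monoˡ-≤ (2 + p) 2≤D) Dᵘ≤1)) λ ()
  where
  2≤D : 2 ≤ D
  2≤D = ≤-trans (*-monoʳ-≤ 2 {1} {2 + p} (s≤s z≤n)) 2[2+p]≤D
D*S[m∸1,p]<S[m,1+p] {p} {D} (suc e) 1≤p 2[2+p]≤D Dᵘ≤2^[1+e] =
  p^e*[D+p]<[1+p]^e⇒D*S[e,p]<S[1+e,1+p] p e D (p^e*[D+p]<[1+p]^e {e = e} 1≤p 2[2+p]≤D Dᵘ≤2^[1+e])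

D*S[n∸s∸1,p]<S[n∸s,1+p] : ∀ {p a s D} n → 1 ≤ p → 2 * (2 + p) ≤ D → 2 + p + s ≤ a → D ^ a ≤ 2 ^ n →
                           D * S (n ∸ s ∸ 1) p < S (n ∸ s) (suc p)
D*S[n∸s∸1,p]<S[n∸s,1+p] {p} {a} {s} {D} n 1≤p 2[2+p]≤D 2+p+s≤a Dᵃ≤2ⁿ =
  D*S[m∸1,p]<S[m,1+p] (n ∸ s) 1≤p 2[2+p]≤D (*-cancelˡ-≤ (2 ^ s) {{m^n≢0 2 s}} (begin
    2 ^ s * D ^ (2 + p)   ≤⟨ *-monoˡ-≤ (D ^ (2 + p)) (^-monoˡ-≤ s 2≤D) ⟩
    D ^ s * D ^ (2 + p)   ≡⟨ ^-distribˡ-+-* D s (2 + p) ⟨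
    D ^ (s + (2 + p))     ≤⟨ ^-monoʳ-≤ D {{>-nonZero (≤-trans (s≤s z≤n) 2≤D)}} (≤-trans (≤-reflexive (+-comm s (2 + p))) 2+p+s≤a) ⟩
    D ^ a                 ≤⟨ Dᵃ≤2ⁿ ⟩
    2 ^ n                 ≤⟨ ^-monoʳ-≤ 2 (m≤n+m∸n n s) ⟩
    2 ^ (s + (n ∸ s))     ≡⟨ ^-distribˡ-+-* 2 s (n ∸ s) ⟩
    2 ^ s * 2 ^ (n ∸ s)   ∎))
  where
  open ≤-Reasoning
  2≤D : 2 ≤ D
  2≤D = ≤-trans (*-monoʳ-≤ 2 {1} {2 + p} (s≤s z≤n)) 2[2+p]≤D

2≤k∸t∸s×k∸t∸s+s≤j∸t : ∀ {t j k s} → k ≤ j → s + t + 2 ≤ k → 2 ≤ k ∸ t ∸ s × k ∸ t ∸ s + s ≤ j ∸ t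
2≤k∸t∸s×k∸t∸s+s≤j∸t {t} {j} {k} {s} k≤j s+t+2≤k =
    subst (2 ≤_) (sym (∸-+-assoc k t s)) (m+n≤o⇒m≤o∸n 2 (≤-trans (≤-reflexive (reorder s t)) s+t+2≤k))
  , (begin
    k ∸ t ∸ s + s ≡⟨ m∸n+n≡m (m+n≤o⇒m≤o∸n s (m+n≤o⇒m≤o (s + t) s+t+2≤k)) ⟩
    k ∸ t         ≤⟨ ∸-monoˡ-≤ t k≤j ⟩
    j ∸ t         ∎)
  where
  open ≤-Reasoning
  reorder : ∀ s t → 2 + (t + s) ≡ s + t + 2
  reorder = solve-∀

lemma2p3 : (t j k s : ℕ) → 1 ≤ t → k ≤ j → t + 2 ≤ k → s + t + 2 ≤ k →
    ((n : ℕ) → t ≤ n →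
       ((t + 1) * (j ∸ t + 1)) ^ (j ∸ t + 1) ≤ 2 ^ (n ∸ t) →
       (t + 1) * (j ∸ t + 1) * S (n ∸ t ∸ s ∸ 1) (k ∸ t ∸ s ∸ 1)
         < S (n ∸ t ∸ s) (k ∸ t ∸ s))
    × ((n : ℕ) → t ≤ n →
       ((t + 1) * (j ∸ t + 1)) ^ (2 * (j ∸ t + 1)) ≤ 2 ^ (n ∸ t) →
       (t + 1) ^ 2 * (j ∸ t + 1) ^ 2 * S (n ∸ t ∸ s ∸ 1) (k ∸ t ∸ s ∸ 1)
         < S (n ∸ t ∸ s) (k ∸ t ∸ s))
-- Abstracting k ∸ t ∸ s as suc p makes k ∸ t ∸ s ∸ 1 reduce to p.
lemma2p3 t j k s 1≤t k≤j _ s+t+2≤k with k ∸ t ∸ s | 2≤k∸t∸s×k∸t∸s+s≤j∸t {t} {j} {k} {s} k≤j s+t+2≤k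
... | suc p | s≤s 1≤p , 1+p+s≤j∸t =
    (λ n _ Cᵃ≤2^[n∸t] → D*S[n∸s∸1,p]<S[n∸s,1+p] (n ∸ t) 1≤p 2[2+p]≤C 2+p+s≤a Cᵃ≤2^[n∸t])
  , (λ n _ C²ᵃ≤2^[n∸t] → subst (λ c → c * S (n ∸ t ∸ s ∸ 1) p < S (n ∸ t ∸ s) (suc p))
      (^-distribʳ-* (t + 1) a 2)
      (D*S[n∸s∸1,p]<S[n∸s,1+p] (n ∸ t) 1≤p 2[2+p]≤C² 2+p+s≤a
        (≤-trans (≤-reflexive (^-*-assoc C 2 a)) C²ᵃ≤2^[n∸t])))
  where
  a = j ∸ t + 1
  C = (t + 1) * a
  2+p+s≤a : 2 + p + s ≤ a
  2+p+s≤a = ≤-trans (s≤s 1+p+s≤j∸t) (≤-reflexive (+-comm 1 (j ∸ t)))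
  2[2+p]≤C : 2 * (2 + p) ≤ C
  2[2+p]≤C = *-mono-≤ (+-monoˡ-≤ 1 1≤t) (m+n≤o⇒m≤o (2 + p) 2+p+s≤a)
  2[2+p]≤C² : 2 * (2 + p) ≤ C ^ 2
  2[2+p]≤C² = ≤-trans 2[2+p]≤C (≤-trans (≤-reflexive (sym (^-identityʳ C)))
                (^-monoʳ-≤ C {{>-nonZero (≤-trans (s≤s z≤n) 2[2+p]≤C)}} {1} {2} (s≤s z≤n)))
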